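{- Let $\Gamma$ be a finite group of order $n$, $H\subseteq\Gamma$ nonempty with $|H|=h$, and let $G=\mathrm{Cay}(\Gamma,H)$ have girth $m$. Let the activation threshold be $t=h$. Then for $1\le s\le n$, $d_{st}(G)=n-s$ whenever $s>n-m$, and $d_{st}(G)=\infty$ otherwise.
   Context: The Cayley digraph $\mathrm{Cay}(\Gamma,H)$ has vertex set $\Gamma$ and an edge from $x$ to $y$ whenever $y=hx$ for some $h\in H$. The girth of a digraph is the minimum length of a directed cycle in it. Activation process: given a digraph with vertex set $V$, a set $S\subseteq V$ and threshold $t$, put $S_0=S$ and $S_i=S_{i-1}\cup\{v\notin S_{i-1}: v \text{ has at least } t \text{ edges } (u,v) \text{ with } u\in S_{i-1}\}$ for $i\ge1$. $d(S,t)$ is the smallest $i$ with $S_i=V$ ($\infty$ if none exists), and $d_{st}(G)=\max\{d(S,t): S\subseteq V,\ |S|=s\}$. -}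

module Defs where

open import Data.Bool using (Bool; _∨_)
open import Data.Nat using (ℕ; zero; suc; _≤_; _≤?_; _<_)
open import Data.Fin using (Fin; _≟_; fromℕ; inject₁)
import Data.Fin as F
open import Data.Fin.Properties using (any?)
open import Data.Fin.Subset using (Subset; _∈_; ∣_∣; ⊤)
open import Data.Fin.Subset.Properties using (_∈?_)
open import Data.Vec using (tabulate)
open import Data.Product using (Σ; ∃; _×_; _,_)
open import Relation.Nullary using (Dec; ¬_; ⌊_⌋)
open import Relation.Nullary.Decidable using (_×-dec_)
open import Relation.Binary.PropositionalEquality using (_≡_; _≢_)
open import Function.Definitions using (Injective)
open import Algebra.Structures using (IsGroup)
open import Function using (_∘_)

record FinGroup (n : ℕ) : Set where
  field
    _∙_ : Fin n → Fin n → Fin n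
    ε   : Fin n
    _⁻¹ : Fin n → Fin n
    isGroup : IsGroup _≡_ _∙_ ε _⁻¹

module _ {n : ℕ} (Γ : FinGroup n) (H : Subset n) where
  open FinGroup Γ

  Edge : Fin n → Fin n → Set
  Edge x y = ∃ λ g → g ∈ H × y ≡ g ∙ x

  edge? : ∀ x y → Dec (Edge x y)
  edge? x y = any? λ g → (g ∈? H) ×-dec (y ≟ g ∙ x)

  DirectedCycle : ℕ → Set
  DirectedCycle ℓ =
    1 ≤ ℓ × Σ (Fin (suc ℓ) → Fin n) λ c →
      (c F.zero ≡ c (fromℕ ℓ)) ×
      ((i : Fin ℓ) → Edge (c (inject₁ i)) (c (F.suc i))) ×
      Injective _≡_ _≡_ (c ∘ inject₁)

  IsGirth : ℕ → Set
  IsGirth m = DirectedCycle m × (∀ ℓ → DirectedCycle ℓ → m ≤ ℓ)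

  module _ (t : ℕ) where
    inFrom : Subset n → Fin n → Subset n
    inFrom S v = tabulate λ u → ⌊ (u ∈? S) ×-dec edge? u v ⌋

    step : Subset n → Subset n
    step S = tabulate λ v → ⌊ v ∈? S ⌋ ∨ ⌊ t ≤? ∣ inFrom S v ∣ ⌋

    stage : Subset n → ℕ → Subset n
    stage S zero = S
    stage S (suc i) = step (stage S i)

    ActTime : Subset n → ℕ → Set
    ActTime S k = stage S k ≡ ⊤ × (∀ j → j < k → stage S j ≢ ⊤)

    NeverActive : Subset n → Set
    NeverActive S = ∀ i → stage S i ≢ ⊤

    DstIs : ℕ → ℕ → Set
    DstIs s k =
      (∀ S → ∣ S ∣ ≡ s → ∃ λ j → j ≤ k × ActTime S j) ×
      (∃ λ S → ∣ S ∣ ≡ s × ActTime S k)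

    DstInf : ℕ → Set
    DstInf s = ∃ λ S → ∣ S ∣ ≡ s × NeverActive S

-- Every vertex v of Cay(Γ,H) has exactly |H| in-neighbours, namely h⁻¹v for h ∈ H, so with
-- threshold |H| a vertex becomes active exactly when all its in-neighbours are active. Hence
-- v is inactive at stage i iff some walk of length i ending at v avoids S. A walk of length
-- k < m has no repeated vertex, since a repetition would close a cycle shorter than the
-- girth; so when n − s < m no walk of length n − s avoids S, which has only n − s vertices
-- outside it, and everything is active by stage n − s. Conversely, if S avoids the first
-- n − s vertices c₀, c₁, … of a shortest cycle, then cⱼ is still inactive at stage j; and
-- if s ≤ n − m, S can avoid the whole cycle, which then stays inactive forever.
module Submission where

open import Defs
open import Data.Nat using (ℕ; _≤_; _<_; _+_; _∸_)
open import Data.Fin.Subset using (Subset; Nonempty; ∣_∣)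
open import Data.Product using (_×_)

open import Algebra.Bundles using (Group)
import Algebra.Properties.Group as GroupProperties
open import Data.Bool using (Bool; true; false; T; _∨_)
open import Data.Bool.Properties using (T-≡; T-∨)
open import Data.Empty using (⊥-elim)
open import Data.Fin using (Fin; zero; suc; toℕ; inject₁; fromℕ; fromℕ<)
import Data.Fin.Properties as Finₚ
open Finₚ using (toℕ-injective; toℕ-inject₁; toℕ-fromℕ; toℕ<n; any?)
open import Data.Fin.Subset using (_∈_; _∉_; _⊆_; ⊤; ⊥; ∁; _∪_; ⁅_⁆; _-_)
open import Data.Fin.Subset.Properties
  using (_∈?_; ∈⊤; ⊆⊤; ⊆-antisym; ∉⊥; ∣⊥∣≡0; ∣⊤∣≡n; ∣⁅x⁆∣≡1; ∣p∣≤∣x∷p∣; ∣∁p∣≡n∸∣p∣;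
         x∈p⇒∣p-x∣<∣p∣; x∈p∧x≢y⇒x∈p-y; x∈∁p⇒x∉p; x∉p⇒x∈∁p; x∈p∪q⁺; x∈⁅x⁆)
open import Data.Nat using (zero; suc; z≤n; s≤s; _≤?_; _≤′_; ≤′-refl; ≤′-step)
open import Data.Nat.Induction using (<-rec)
open import Data.Nat.Properties
open import Data.Product using (∃; _,_; proj₁)
open import Data.Sum using (_⊎_; inj₁; inj₂)
open import Data.Vec using ([]; _∷_; tabulate; here; there)
open import Data.Vec.Properties using (lookup∘tabulate; []=⇒lookup; lookup⇒[]=; ≡-dec)
import Data.Bool as Bool
open import Function using (_∘_; flip)
open import Level using (_⊔_)
open import Function.Bundles using (Equivalence)
open import Function.Definitions using (Injective)
open import Relation.Binary using (Rel; tri<; tri≈; tri>)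
open import Relation.Binary.PropositionalEquality
open import Relation.Nullary using (Dec; yes; no; ¬_; ⌊_⌋)
open import Relation.Nullary.Decidable using (_×-dec_; ¬?; toWitness; fromWitness; decidable-stable)

∈-tabulate⁺ : ∀ {k} (f : Fin k → Bool) {v} → T (f v) → v ∈ tabulate f
∈-tabulate⁺ f {v} fv = lookup⇒[]= v _ (trans (lookup∘tabulate f v) (Equivalence.to T-≡ fv))

∈-tabulate⁻ : ∀ {k} (f : Fin k → Bool) {v} → v ∈ tabulate f → T (f v)
∈-tabulate⁻ f {v} v∈ = Equivalence.from T-≡ (trans (sym (lookup∘tabulate f v)) ([]=⇒lookup v∈))

all∈⇒≡⊤ : ∀ {k} {p : Subset k} → (∀ v → v ∈ p) → p ≡ ⊤
all∈⇒≡⊤ all = ⊆-antisym ⊆⊤ (λ {v} _ → all v)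

injection⇒∣p∣≤∣q∣ : ∀ {a b} (f : Fin a → Fin b) → Injective _≡_ _≡_ f →
                    (p : Subset a) (q : Subset b) → (∀ {x} → x ∈ p → f x ∈ q) → ∣ p ∣ ≤ ∣ q ∣
injection⇒∣p∣≤∣q∣ f inj [] q f[p]⊆q = z≤n
injection⇒∣p∣≤∣q∣ f inj (false ∷ p) q f[p]⊆q =
  injection⇒∣p∣≤∣q∣ (f ∘ suc) (Finₚ.suc-injective ∘ inj) p q (f[p]⊆q ∘ there)
injection⇒∣p∣≤∣q∣ f inj (true ∷ p) q f[p]⊆q =
  ≤-trans (s≤s (injection⇒∣p∣≤∣q∣ (f ∘ suc) (Finₚ.suc-injective ∘ inj)
                 p (q - f zero) λ x∈p →
                 x∈p∧x≢y⇒x∈p-y (f[p]⊆q (there x∈p)) (λ e → Finₚ.0≢1+n (sym (inj e)))))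
          (x∈p⇒∣p-x∣<∣p∣ (f[p]⊆q here))

∣p∪q∣≤∣p∣+∣q∣ : ∀ {k} (p q : Subset k) → ∣ p ∪ q ∣ ≤ ∣ p ∣ + ∣ q ∣
∣p∪q∣≤∣p∣+∣q∣ [] [] = z≤n
∣p∪q∣≤∣p∣+∣q∣ (true ∷ p) (b ∷ q) =
  s≤s (≤-trans (∣p∪q∣≤∣p∣+∣q∣ p q) (+-monoʳ-≤ ∣ p ∣ (∣p∣≤∣x∷p∣ b q)))
∣p∪q∣≤∣p∣+∣q∣ (false ∷ p) (true ∷ q) =
  subst (suc ∣ p ∪ q ∣ ≤_) (sym (+-suc ∣ p ∣ ∣ q ∣)) (s≤s (∣p∪q∣≤∣p∣+∣q∣ p q))
∣p∪q∣≤∣p∣+∣q∣ (false ∷ p) (false ∷ q) = ∣p∪q∣≤∣p∣+∣q∣ p q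

∃-⊆-of-size : ∀ {k} (p : Subset k) {s} → s ≤ ∣ p ∣ → ∃ λ q → q ⊆ p × ∣ q ∣ ≡ s
∃-⊆-of-size {k} p {zero} _ = ⊥ , (λ x∈⊥ → ⊥-elim (∉⊥ x∈⊥)) , ∣⊥∣≡0 k
∃-⊆-of-size (false ∷ p) {suc s} s<∣p∣ with ∃-⊆-of-size p s<∣p∣
... | q , q⊆p , ∣q∣≡s = (false ∷ q) , (λ { (there x∈q) → there (q⊆p x∈q) }) , ∣q∣≡s
∃-⊆-of-size (true ∷ p) {suc s} (s≤s s≤∣p∣) with ∃-⊆-of-size p s≤∣p∣
... | q , q⊆p , ∣q∣≡s =
  (true ∷ q) , (λ { here → here ; (there x∈q) → there (q⊆p x∈q) }) , cong suc ∣q∣≡s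

imageBelow : ∀ {k} → ℕ → (ℕ → Fin k) → Subset k
imageBelow zero w = ⊥
imageBelow (suc ℓ) w = ⁅ w ℓ ⁆ ∪ imageBelow ℓ w

∣imageBelow∣≤ : ∀ {k} ℓ (w : ℕ → Fin k) → ∣ imageBelow ℓ w ∣ ≤ ℓ
∣imageBelow∣≤ {k} zero w = ≤-reflexive (∣⊥∣≡0 k)
∣imageBelow∣≤ (suc ℓ) w = ≤-trans (∣p∪q∣≤∣p∣+∣q∣ ⁅ w ℓ ⁆ (imageBelow ℓ w))
  (subst (λ a → a + ∣ imageBelow ℓ w ∣ ≤ suc ℓ) (sym (∣⁅x⁆∣≡1 (w ℓ))) (s≤s (∣imageBelow∣≤ ℓ w)))

∈-imageBelow : ∀ {k ℓ x} (w : ℕ → Fin k) → x < ℓ → w x ∈ imageBelow ℓ w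
∈-imageBelow {ℓ = suc ℓ} w (s≤s x≤ℓ) with m≤n⇒m<n∨m≡n x≤ℓ
... | inj₁ x<ℓ = x∈p∪q⁺ (inj₂ (∈-imageBelow w x<ℓ))
... | inj₂ refl = x∈p∪q⁺ (inj₁ (x∈⁅x⁆ (w ℓ)))

∃-avoiding : ∀ {k s} ℓ (w : ℕ → Fin k) → s + ℓ ≤ k →
             ∃ λ S → ∣ S ∣ ≡ s × (∀ {x} → x < ℓ → w x ∉ S)
∃-avoiding {k} {s} ℓ w s+ℓ≤k with ∃-⊆-of-size (∁ (imageBelow ℓ w)) room
  where
  room : s ≤ ∣ ∁ (imageBelow ℓ w) ∣
  room = subst (s ≤_) (sym (∣∁p∣≡n∸∣p∣ (imageBelow ℓ w)))
           (≤-trans (m+n≤o⇒m≤o∸n s s+ℓ≤k) (∸-monoʳ-≤ k (∣imageBelow∣≤ ℓ w)))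
... | S , S⊆∁im , ∣S∣≡s =
  S , ∣S∣≡s , λ x<ℓ x∈S → x∈∁p⇒x∉p (S⊆∁im x∈S) (∈-imageBelow w x<ℓ)

upward-closed-mono : {P : ℕ → Set} → (∀ j → P j → P (suc j)) → ∀ {i k} → i ≤ k → P i → P k
upward-closed-mono {P} up {i} i≤k pi = go (≤⇒≤′ i≤k)
  where
  go : ∀ {k} → i ≤′ k → P k
  go ≤′-refl = pi
  go (≤′-step i≤′k) = up _ (go i≤′k)

least-upward-closed : {P : ℕ → Set} → (∀ j → Dec (P j)) → (∀ j → P j → P (suc j)) →
                      ∀ k → P k → ∃ λ j → j ≤ k × P j × (∀ i → i < j → ¬ P i)
least-upward-closed P? up zero p = zero , z≤n , p , λ _ ()
least-upward-closed P? up (suc k) p with P? k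
... | yes pk = let j , j≤k , pj , below = least-upward-closed P? up k pk
               in j , m≤n⇒m≤1+n j≤k , pj , below
... | no ¬pk = suc k , ≤-refl , p , λ i i<k+1 → ¬pk ∘ upward-closed-mono up (≤-pred i<k+1)

Walk : ∀ {a r} {A : Set a} → Rel A r → ℕ → (ℕ → A) → Set r
Walk R ℓ w = ∀ {x} → x < ℓ → R (w x) (w (suc x))

ClosedWalk : ∀ {a r} {A : Set a} → Rel A r → ℕ → (ℕ → A) → Set (a ⊔ r)
ClosedWalk R ℓ w = Walk R ℓ w × w 0 ≡ w ℓ

module _ {a r} {A : Set a} {R : Rel A r} where

  walk-reverse : ∀ {ℓ w} → Walk R ℓ w → Walk (flip R) ℓ (λ x → w (ℓ ∸ x))
  walk-reverse {ℓ} {w} walk {x} x<ℓ =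
    subst (R (w (ℓ ∸ suc x)) ∘ w) (sym (+-∸-assoc 1 x<ℓ))
      (walk (∸-monoʳ-< {ℓ} {suc x} {0} (s≤s z≤n) x<ℓ))

  closedWalk-slice : ∀ {ℓ w x y} → Walk R ℓ w → x < y → y ≤ ℓ → w x ≡ w y →
                     ClosedWalk R (y ∸ x) (λ z → w (x + z))
  closedWalk-slice {ℓ} {w} {x} {y} walk x<y y≤ℓ wx≡wy = slice , closed
    where
    x+[y∸x]≡y : x + (y ∸ x) ≡ y
    x+[y∸x]≡y = m+[n∸m]≡n (<⇒≤ x<y)
    slice : Walk R (y ∸ x) (λ z → w (x + z))
    slice {z} z<y∸x = subst (R (w (x + z)) ∘ w) (sym (+-suc x z))
      (walk (≤-trans (subst (x + z <_) x+[y∸x]≡y (+-monoʳ-< x z<y∸x)) y≤ℓ))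
    closed : w (x + 0) ≡ w (x + (y ∸ x))
    closed = trans (cong w (+-identityʳ x)) (trans wx≡wy (cong w (sym x+[y∸x]≡y)))

  closedWalk-predecessor : ∀ {ℓ w x} → ClosedWalk R ℓ w → x < ℓ → ∃ λ p → p < ℓ × R (w p) (w x)
  closedWalk-predecessor {suc ℓ} {w} {zero} (walk , closed) _ =
    ℓ , n<1+n ℓ , subst (R (w ℓ)) (sym closed) (walk (n<1+n ℓ))
  closedWalk-predecessor {suc ℓ} {x = suc x} (walk , _) x<ℓ =
    x , <-trans (n<1+n x) x<ℓ , walk (<-trans (n<1+n x) x<ℓ)

distinct⇒injective : ∀ {a} {A : Set a} {k} (w : ℕ → A) →
                     (∀ {x y} → x < y → y < k → w x ≢ w y) →
                     Injective _≡_ _≡_ (λ (i : Fin k) → w (toℕ i))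
distinct⇒injective w distinct {i} {j} wi≡wj with <-cmp (toℕ i) (toℕ j)
... | tri< i<j _ _ = ⊥-elim (distinct i<j (toℕ<n j) wi≡wj)
... | tri≈ _ i≡j _ = toℕ-injective i≡j
... | tri> _ _ j<i = ⊥-elim (distinct j<i (toℕ<n i) (sym wi≡wj))

-- min x m, which extends a sequence indexed by Fin (suc m) to one indexed by ℕ.
clamp : (m : ℕ) → ℕ → Fin (suc m)
clamp m zero = zero
clamp zero (suc x) = zero
clamp (suc m) (suc x) = suc (clamp m x)

clamp-self : ∀ m → clamp m m ≡ fromℕ m
clamp-self zero = refl
clamp-self (suc m) = cong suc (clamp-self m)

clamp-inject₁ : ∀ {m x} (x<m : x < m) → clamp m x ≡ inject₁ (fromℕ< x<m)
clamp-inject₁ {suc m} {zero} _ = refl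
clamp-inject₁ {suc m} {suc x} (s≤s x<m) = cong suc (clamp-inject₁ x<m)

clamp-suc : ∀ {m x} (x<m : x < m) → clamp m (suc x) ≡ suc (fromℕ< x<m)
clamp-suc {suc m} {zero} _ = refl
clamp-suc {suc m} {suc x} (s≤s x<m) = cong suc (clamp-suc x<m)

module _ {n : ℕ} (Γ : FinGroup n) (H : Subset n) where
  open FinGroup Γ

  private
    group : Group _ _
    group = record { _≈_ = _≡_ ; _∙_ = _∙_ ; ε = ε ; _⁻¹ = _⁻¹ ; isGroup = isGroup }
    open GroupProperties group
      using (∙-cancelˡ; ∙-cancelʳ; ⁻¹-injective; \\-leftDividesˡ; //-rightDividesʳ)
    open Group group using (_\\_; _//_)

    _⟶_ : Fin n → Fin n → Set
    _⟶_ = Edge Γ H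

    inFromₕ : Subset n → Fin n → Subset n
    inFromₕ = inFrom Γ H ∣ H ∣

    stepₕ : Subset n → Subset n
    stepₕ = step Γ H ∣ H ∣

    stageₕ : Subset n → ℕ → Subset n
    stageₕ = stage Γ H ∣ H ∣

  edge-from-left-quotient : ∀ {g} v → g ∈ H → (g \\ v) ⟶ v
  edge-from-left-quotient {g} v g∈H = g , g∈H , sym (\\-leftDividesˡ g v)

  edge⇒right-quotient∈H : ∀ {u v} → u ⟶ v → v // u ∈ H
  edge⇒right-quotient∈H {u} (g , g∈H , refl) =
    subst (_∈ H) (sym (//-rightDividesʳ u g)) g∈H

  ∈-inFrom⁺ : ∀ {T u v} → u ∈ T → u ⟶ v → u ∈ inFromₕ T v
  ∈-inFrom⁺ {T} {v = v} u∈T u⟶v =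
    ∈-tabulate⁺ (λ u → ⌊ (u ∈? T) ×-dec edge? Γ H u v ⌋) (fromWitness (u∈T , u⟶v))

  ∈-inFrom⁻ : ∀ {T u v} → u ∈ inFromₕ T v → u ∈ T × u ⟶ v
  ∈-inFrom⁻ {T} {v = v} = toWitness ∘ ∈-tabulate⁻ (λ u → ⌊ (u ∈? T) ×-dec edge? Γ H u v ⌋)

  ∣H∣≤∣inFrom∣ : ∀ {T v} → (∀ {u} → u ⟶ v → u ∈ T) → ∣ H ∣ ≤ ∣ inFromₕ T v ∣
  ∣H∣≤∣inFrom∣ {T} {v} preds⊆T = injection⇒∣p∣≤∣q∣ (_\\ v)
    (λ {g} {h} e → ⁻¹-injective (∙-cancelʳ v (g ⁻¹) (h ⁻¹) e)) H _
    λ g∈H → let u⟶v = edge-from-left-quotient v g∈H in ∈-inFrom⁺ (preds⊆T u⟶v) u⟶v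

  ∣inFrom∣<∣H∣ : ∀ {T u v} → u ∉ T → u ⟶ v → ∣ inFromₕ T v ∣ < ∣ H ∣
  ∣inFrom∣<∣H∣ {T} {u} {v} u∉T u⟶v =
    <-≤-trans (s≤s (injection⇒∣p∣≤∣q∣ (v //_) //-injective _ (H - (v // u)) maps-into))
              (x∈p⇒∣p-x∣<∣p∣ (edge⇒right-quotient∈H u⟶v))
    where
    //-injective : Injective _≡_ _≡_ (v //_)
    //-injective {x} {y} e = ⁻¹-injective (∙-cancelˡ v (x ⁻¹) (y ⁻¹) e)
    maps-into : ∀ {x} → x ∈ inFromₕ T v → v // x ∈ H - (v // u)
    maps-into x∈ = let x∈T , x⟶v = ∈-inFrom⁻ x∈ in
      x∈p∧x≢y⇒x∈p-y (edge⇒right-quotient∈H x⟶v) (λ e → u∉T (subst (_∈ T) (//-injective e) x∈T))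

  ∈-step⁺ : ∀ {T v} → v ∈ T ⊎ (∀ {u} → u ⟶ v → u ∈ T) → v ∈ stepₕ T
  ∈-step⁺ {T} {v} active = ∈-tabulate⁺ (λ v → ⌊ v ∈? T ⌋ ∨ ⌊ ∣ H ∣ ≤? ∣ inFromₕ T v ∣ ⌋)
    (Equivalence.from (T-∨ {⌊ v ∈? T ⌋})
      (Data.Sum.map fromWitness (fromWitness ∘ ∣H∣≤∣inFrom∣) active))

  ∈-step⁻ : ∀ {T v} → v ∈ stepₕ T → v ∈ T ⊎ (∀ {u} → u ⟶ v → u ∈ T)
  ∈-step⁻ {T} {v} v∈ with Equivalence.to (T-∨ {⌊ v ∈? T ⌋})
                            (∈-tabulate⁻ (λ v → ⌊ v ∈? T ⌋ ∨ ⌊ ∣ H ∣ ≤? ∣ inFromₕ T v ∣ ⌋) v∈)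
  ... | inj₁ v∈T = inj₁ (toWitness v∈T)
  ... | inj₂ ∣H∣≤ = inj₂ λ {u} u⟶v →
          decidable-stable (u ∈? T) λ u∉T → <⇒≱ (∣inFrom∣<∣H∣ u∉T u⟶v) (toWitness ∣H∣≤)

  ∉-step : ∀ {T u v} → v ∉ T → u ⟶ v → u ∉ T → v ∉ stepₕ T
  ∉-step v∉T u⟶v u∉T v∈ with ∈-step⁻ v∈
  ... | inj₁ v∈T = v∉T v∈T
  ... | inj₂ preds∈T = u∉T (preds∈T u⟶v)

  ∉-step⇒inactive-predecessor : ∀ {T v} → v ∉ stepₕ T → ∃ λ u → u ⟶ v × u ∉ T
  ∉-step⇒inactive-predecessor {T} {v} v∉ with any? (λ u → edge? Γ H u v ×-dec ¬? (u ∈? T))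
  ... | yes found = found
  ... | no none = ⊥-elim (v∉ (∈-step⁺ (inj₂ λ {u} u⟶v →
                    decidable-stable (u ∈? T) λ u∉T → none (u , u⟶v , u∉T))))

  step-⊤ : stepₕ ⊤ ≡ ⊤
  step-⊤ = all∈⇒≡⊤ λ _ → ∈-step⁺ (inj₁ ∈⊤)

  ⊆-stage : ∀ {S} i → S ⊆ stageₕ S i
  ⊆-stage zero v∈S = v∈S
  ⊆-stage (suc i) v∈S = ∈-step⁺ (inj₁ (⊆-stage i v∈S))

  ∃-ActTime : ∀ {S k} → stageₕ S k ≡ ⊤ → ∃ λ j → j ≤ k × ActTime Γ H ∣ H ∣ S j
  ∃-ActTime {S} {k} =
    least-upward-closed (λ j → ≡-dec Bool._≟_ (stageₕ S j) ⊤)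
                        (λ _ stage≡⊤ → trans (cong stepₕ stage≡⊤) step-⊤) k

  ∉-stage⇒walk : ∀ {S} i {v} → v ∉ stageₕ S i →
                 ∃ λ b → b 0 ≡ v × Walk (flip _⟶_) i b × (∀ {x} → x ≤ i → b x ∉ S)
  ∉-stage⇒walk zero {v} v∉S = (λ _ → v) , refl , (λ ()) , λ _ → v∉S
  ∉-stage⇒walk {S} (suc i) {v} v∉ with ∉-step⇒inactive-predecessor v∉
  ... | u , u⟶v , u∉ with ∉-stage⇒walk i u∉
  ... | b , refl , walk , avoids = b′ , refl , walk′ , avoids′
    where
    b′ : ℕ → Fin n
    b′ zero = v
    b′ (suc x) = b x
    walk′ : Walk (flip _⟶_) (suc i) b′
    walk′ {zero} _ = u⟶v
    walk′ {suc x} (s≤s x<i) = walk x<i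
    avoids′ : ∀ {x} → x ≤ suc i → b′ x ∉ S
    avoids′ {zero} _ = v∉ ∘ ⊆-stage (suc i)
    avoids′ {suc x} (s≤s x≤i) = avoids x≤i

  ∉-stage-invariant : ∀ {S} (P : ℕ → Fin n → Set) → (∀ {v} → P 0 v → v ∉ S) →
                      (∀ i {v} → P (suc i) v → P i v × ∃ λ u → u ⟶ v × P i u) →
                      ∀ i {v} → P i v → v ∉ stageₕ S i
  ∉-stage-invariant P base persist zero pv = base pv
  ∉-stage-invariant P base persist (suc i) pv =
    let pv′ , u , u⟶v , pu = persist i pv
    in ∉-step (∉-stage-invariant P base persist i pv′) u⟶v
              (∉-stage-invariant P base persist i pu)

  walk-delays-activation : ∀ {S k w} → Walk _⟶_ k w → (∀ {x} → x < k → w x ∉ S) →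
                           ∀ {j} → j < k → w j ∉ stageₕ S j
  walk-delays-activation {S} {k} {w} walk avoids {j} j<k =
    ∉-stage-invariant P (λ { (x , _ , x<k , refl) → avoids x<k }) persist j
                      (j , ≤-refl , j<k , refl)
    where
    P : ℕ → Fin n → Set
    P i v = ∃ λ x → i ≤ x × x < k × v ≡ w x
    persist : ∀ i {v} → P (suc i) v → P i v × ∃ λ u → u ⟶ v × P i u
    persist _ (suc x , s≤s i≤x , x+1<k , refl) =
      (suc x , m≤n⇒m≤1+n i≤x , x+1<k , refl) ,
      w x , walk x<k , (x , i≤x , x<k , refl)
      where
      x<k : x < k
      x<k = <-trans (n<1+n x) x+1<k

  closedWalk-never-activated : ∀ {S ℓ w} → ClosedWalk _⟶_ ℓ w → (∀ {x} → x < ℓ → w x ∉ S) →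
                               ∀ i {x} → x < ℓ → w x ∉ stageₕ S i
  closedWalk-never-activated {S} {ℓ} {w} closedWalk avoids i x<ℓ =
    ∉-stage-invariant P (λ { (x , x<ℓ , refl) → avoids x<ℓ }) persist i (_ , x<ℓ , refl)
    where
    P : ℕ → Fin n → Set
    P _ v = ∃ λ x → x < ℓ × v ≡ w x
    persist : ∀ i {v} → P (suc i) v → P i v × ∃ λ u → u ⟶ v × P i u
    persist _ (x , x<ℓ , refl) =
      let p , p<ℓ , wp⟶wx = closedWalk-predecessor {R = _⟶_} closedWalk x<ℓ
      in (x , x<ℓ , refl) , w p , wp⟶wx , (p , p<ℓ , refl)

  closedWalk⇒DirectedCycle : ∀ {ℓ w} → 1 ≤ ℓ → ClosedWalk _⟶_ ℓ w →
                             Injective _≡_ _≡_ (λ (i : Fin ℓ) → w (toℕ i)) → DirectedCycle Γ H ℓ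
  closedWalk⇒DirectedCycle {ℓ} {w} 1≤ℓ (walk , closed) inj =
    1≤ℓ , w ∘ toℕ , trans closed (cong w (sym (toℕ-fromℕ ℓ))) ,
    (λ i → subst (_⟶ w (suc (toℕ i))) (cong w (sym (toℕ-inject₁ i))) (walk (toℕ<n i))) ,
    λ e → inj (subst₂ (λ x y → w x ≡ w y) (toℕ-inject₁ _) (toℕ-inject₁ _) e)

  DirectedCycle⇒closedWalk : ∀ {ℓ} → DirectedCycle Γ H ℓ → ∃ (ClosedWalk _⟶_ ℓ)
  DirectedCycle⇒closedWalk {ℓ} (_ , c , c₀≡cℓ , edges , _) =
    c ∘ clamp ℓ ,
    (λ x<ℓ → subst₂ _⟶_ (cong c (sym (clamp-inject₁ x<ℓ))) (cong c (sym (clamp-suc x<ℓ)))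
                        (edges (fromℕ< x<ℓ))) ,
    trans c₀≡cℓ (cong c (sym (clamp-self ℓ)))

  module _ (m : ℕ) (girth-minimal : ∀ ℓ → DirectedCycle Γ H ℓ → m ≤ ℓ) where

    -- As m ≤ ℓ is decidable we may argue by contradiction: if ℓ < m, a repeated vertex
    -- would cut out a shorter closed walk, whose length is ≥ m by induction.
    girth≤closedWalk : ∀ ℓ {w} → 1 ≤ ℓ → ClosedWalk _⟶_ ℓ w → m ≤ ℓ
    girth≤closedWalk = <-rec _ λ ℓ shorter {w} 1≤ℓ closedWalk@(walk , _) →
      decidable-stable (m ≤? ℓ) λ m≰ℓ →
        let repeat⇒m≤ℓ : ∀ {x y} → x < y → y < ℓ → w x ≡ w y → m ≤ ℓ
            repeat⇒m≤ℓ {x} {y} x<y y<ℓ wx≡wy = ≤-trans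
              (shorter (≤-<-trans (m∸n≤m y x) y<ℓ) (m<n⇒0<n∸m x<y)
                       (closedWalk-slice {R = _⟶_} walk x<y (<⇒≤ y<ℓ) wx≡wy))
              (≤-trans (m∸n≤m y x) (<⇒≤ y<ℓ))
        in m≰ℓ (girth-minimal ℓ (closedWalk⇒DirectedCycle 1≤ℓ closedWalk
                 (distinct⇒injective w λ x<y y<ℓ → m≰ℓ ∘ repeat⇒m≤ℓ x<y y<ℓ)))

    ∉-stage⇒k<∣∁S∣ : ∀ {S k v} → k < m → v ∉ stageₕ S k → k < ∣ ∁ S ∣
    ∉-stage⇒k<∣∁S∣ {S} {k} k<m v∉ with ∉-stage⇒walk k v∉
    ... | b , _ , walk , avoids =
      subst (_≤ ∣ ∁ S ∣) (∣⊤∣≡n (suc k))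
        (injection⇒∣p∣≤∣q∣ (w ∘ toℕ) (distinct⇒injective w distinct) ⊤ (∁ S)
          λ {x} _ → x∉p⇒x∈∁p (avoids (m∸n≤m k (toℕ x))))
      where
      w : ℕ → Fin n
      w x = b (k ∸ x)
      distinct : ∀ {x y} → x < y → y < suc k → w x ≢ w y
      distinct {x} {y} x<y y<k+1 wx≡wy = <⇒≱ k<m (≤-trans
        (girth≤closedWalk _ (m<n⇒0<n∸m x<y)
          (closedWalk-slice {R = _⟶_} (walk-reverse {R = flip _⟶_} walk) x<y y≤k wx≡wy))
        (≤-trans (m∸n≤m y x) y≤k))
        where
        y≤k : y ≤ k
        y≤k = ≤-pred y<k+1

    stage-∣∁S∣≡⊤ : ∀ {S k} → ∣ ∁ S ∣ ≡ k → k < m → stageₕ S k ≡ ⊤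
    stage-∣∁S∣≡⊤ {S} {k} ∣∁S∣≡k k<m = all∈⇒≡⊤ λ v →
      decidable-stable (v ∈? stageₕ S k) λ v∉ →
        <-irrefl (sym ∣∁S∣≡k) (∉-stage⇒k<∣∁S∣ {S} k<m v∉)

    Dst≡n∸s : ∀ {s} → DirectedCycle Γ H m → s ≤ n → n < s + m → DstIs Γ H ∣ H ∣ s (n ∸ s)
    Dst≡n∸s {s} cycle s≤n n<s+m = activated , slowest
      where
      n∸s<m : n ∸ s < m
      n∸s<m = subst (n ∸ s <_) (m+n∸m≡n s m) (∸-monoˡ-< n<s+m s≤n)
      ∣∁S∣≡n∸s : ∀ {S} → ∣ S ∣ ≡ s → ∣ ∁ S ∣ ≡ n ∸ s
      ∣∁S∣≡n∸s {S} ∣S∣≡s = trans (∣∁p∣≡n∸∣p∣ S) (cong (n ∸_) ∣S∣≡s)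
      activated : ∀ S → ∣ S ∣ ≡ s → ∃ λ j → j ≤ n ∸ s × ActTime Γ H ∣ H ∣ S j
      activated S ∣S∣≡s = ∃-ActTime (stage-∣∁S∣≡⊤ {S} (∣∁S∣≡n∸s {S} ∣S∣≡s) n∸s<m)
      slowest : ∃ λ S → ∣ S ∣ ≡ s × ActTime Γ H ∣ H ∣ S (n ∸ s)
      slowest with DirectedCycle⇒closedWalk cycle
      ... | w , walk , _ with ∃-avoiding (n ∸ s) w (≤-reflexive (m+[n∸m]≡n s≤n))
      ... | S , ∣S∣≡s , avoids =
        S , ∣S∣≡s , stage-∣∁S∣≡⊤ {S} (∣∁S∣≡n∸s {S} ∣S∣≡s) n∸s<m ,
        λ j j<n∸s stage≡⊤ → walk-delays-activation (λ x<n∸s → walk (<-trans x<n∸s n∸s<m))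
                              avoids j<n∸s (subst (w j ∈_) (sym stage≡⊤) ∈⊤)

  Dst≡∞ : ∀ {m s} → DirectedCycle Γ H m → s + m ≤ n → DstInf Γ H ∣ H ∣ s
  Dst≡∞ {m} cycle s+m≤n with DirectedCycle⇒closedWalk cycle
  ... | w , closedWalk with ∃-avoiding m w s+m≤n
  ... | S , ∣S∣≡s , avoids =
    S , ∣S∣≡s , λ i stage≡⊤ →
      closedWalk-never-activated closedWalk avoids i (proj₁ cycle)
                                 (subst (w 0 ∈_) (sym stage≡⊤) ∈⊤)

theorem2 : (n : ℕ) (Γ : FinGroup n) (H : Subset n) → Nonempty H →
    (m : ℕ) → IsGirth Γ H m →
    (s : ℕ) → 1 ≤ s → s ≤ n →
    (n < s + m → DstIs Γ H ∣ H ∣ s (n ∸ s)) ×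
    (s + m ≤ n → DstInf Γ H ∣ H ∣ s)
theorem2 n Γ H _ m (cycle , girth-minimal) s _ s≤n =
  Dst≡n∸s Γ H m girth-minimal cycle s≤n , Dst≡∞ Γ H cycle
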